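{- Let $K$ be a $k$-family on $[n]$ labelled so that its degree sequence $d(K)$ is weakly decreasing. Then: (i) one can swing from $K$ if and only if $K$ is not shifted; (ii) if one can swing from $K$ to $K'$, then $d(K')\rhd d(K)$; (iii) if $d'$ is a weakly decreasing sequence of positive integers with $d(K)\unrhd d'$, then there exists a $k$-family $K'$ on $[n]$ with $d(K')=d'$ such that $K$ can be obtained from $K'$ by a (possibly empty) sequence of swings.
   Context: A $k$-family on $[n]$ is a collection of distinct $k$-subsets of $[n]$; its degree sequence is $d(K)=(d_1,\dots,d_n)$ with $d_i=|\{S\in K:i\in S\}|$. For sequences $a,b$ of length $n$ with equal sums, $a\unrhd b$ means $a_1+\dots+a_i\ge b_1+\dots+b_i$ for all $i$; $a\rhd b$ means $a\unrhd b$ and $a\ne b$. $K$ is shifted if it is down-closed in the componentwise order on $k$-sets ($\{x_1<\dots<x_k\}\le\{y_1<\dots<y_k\}$ iff $x_i\le y_i$ for all $i$). Swing: if there are $i<j$ in $[n]$ and a $(k-1)$-set $A\subseteq[n]$ containing neither $i$ nor $j$ such that $A\cup\{j\}\in K$ and $A\cup\{i\}\notin K$, then $K'=(K\setminus\{A\cup\{j\}\})\cup\{A\cup\{i\}\}$ is said to be formed by a swing from $K$. -}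

module Defs where

open import Data.Bool using (Bool; true; false; _∧_) renaming (_≟_ to _≟B_)
open import Data.Nat using (ℕ; zero; suc; _≤_; _<_; _∸_)
open import Data.Fin as Fin using (Fin)
open import Data.Fin.Subset using (Subset; inside; outside; _∪_; ⁅_⁆; _∈_; _∉_; ∣_∣)
open import Data.List as List using (List; []; _∷_; _++_; map; length; filter; take)
open import Data.Nat.ListAction using (sum)
open import Data.List.Relation.Binary.Pointwise using (Pointwise)
open import Data.Vec as Vec using (Vec; lookup; tabulate; toList)
open import Data.Product using (Σ; _×_; ∃; ∃-syntax)
open import Data.Sum using (_⊎_)
open import Relation.Binary.PropositionalEquality using (_≡_; _≢_)
open import Relation.Binary.Construct.Closure.ReflexiveTransitive using (Star)
open import Function.Bundles using (_⇔_)

Family : ℕ → Set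
Family n = Subset n → Bool

_∈F_ : ∀ {n} → Subset n → Family n → Set
S ∈F K = K S ≡ true

_∉F_ : ∀ {n} → Subset n → Family n → Set
S ∉F K = K S ≡ false

IsKFamily : ∀ {n} → ℕ → Family n → Set
IsKFamily k K = ∀ S → S ∈F K → ∣ S ∣ ≡ k

allSubsets : (n : ℕ) → List (Subset n)
allSubsets zero = Vec.[] ∷ []
allSubsets (suc n) = map (outside Vec.∷_) (allSubsets n) ++ map (inside Vec.∷_) (allSubsets n)

deg : ∀ {n} → Family n → Vec ℕ n
deg {n} K = tabulate λ i → length (filter (λ S → (K S ∧ lookup S i) ≟B true) (allSubsets n))

sumL : List ℕ → ℕ
sumL = sum

psum : ∀ {n} → ℕ → Vec ℕ n → ℕ
psum m a = sumL (take m (toList a))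

_⊵_ : ∀ {n} → Vec ℕ n → Vec ℕ n → Set
_⊵_ {n} a b = (sumL (toList a) ≡ sumL (toList b)) × (∀ m → m ≤ n → psum m b ≤ psum m a)

_⊳_ : ∀ {n} → Vec ℕ n → Vec ℕ n → Set
a ⊳ b = (a ⊵ b) × (a ≢ b)

WeaklyDecreasing : ∀ {n} → Vec ℕ n → Set
WeaklyDecreasing {n} v = (i j : Fin n) → i Fin.≤ j → lookup v j ≤ lookup v i

Positive : ∀ {n} → Vec ℕ n → Set
Positive {n} v = (i : Fin n) → 0 < lookup v i

elems : ∀ {n} → Subset n → List (Fin n)
elems Vec.[] = []
elems (true Vec.∷ s) = Fin.zero ∷ map Fin.suc (elems s)
elems (false Vec.∷ s) = map Fin.suc (elems s)

_≤c_ : ∀ {n} → Subset n → Subset n → Set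
S ≤c T = Pointwise Fin._≤_ (elems S) (elems T)

Shifted : ∀ {n} → ℕ → Family n → Set
Shifted k K = ∀ S T → ∣ S ∣ ≡ k → ∣ T ∣ ≡ k → T ∈F K → S ≤c T → S ∈F K

Swing : ∀ {n} → ℕ → Family n → Family n → Set
Swing {n} k K K' =
  Σ (Fin n) λ i → Σ (Fin n) λ j → Σ (Subset n) λ A →
    i Fin.< j × suc ∣ A ∣ ≡ k × i ∉ A × j ∉ A
    × (A ∪ ⁅ j ⁆) ∈F K × (A ∪ ⁅ i ⁆) ∉F K
    × (∀ S → S ∈F K' ⇔ ((S ∈F K × S ≢ A ∪ ⁅ j ⁆) ⊎ S ≡ A ∪ ⁅ i ⁆))

CanSwing : ∀ {n} → ℕ → Family n → Set
CanSwing k K = ∃[ K' ] Swing k K K'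

Swings : ∀ {n} → ℕ → Family n → Family n → Set
Swings k = Star (Swing k)

-- A swing trading A ∪ {j} for A ∪ {i} (i < j) moves one unit of degree from j to i: it raises
-- the partial sums over (i, j] by one and fixes all others, which gives (ii).  For (i), a swing
-- site is precisely a violation A ∪ {i} ≤ A ∪ {j} of down-closure; conversely a family closed
-- under these elementary moves is down-closed, by induction on n, moving the least element of
-- a set to 0.  For (iii), if d(K) ⊳ d′ with d′ decreasing there are i < j with d_j < d_i such
-- that d′ lags strictly behind d(K) in the partial sums over (i, j].  Since d_i > d_j, the
-- transposition of i and j cannot map the members of K containing i into K, which yields A with
-- A ∪ {i} ∈ K and A ∪ {j} ∉ K.  Undoing that swing gives a family whose degree sequence still
-- dominates d′ and has smaller sum of partial sums, so the construction terminates.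

module Submission where

open import Defs
open import Data.Bool using (Bool; true; false; _∧_; _∨_; not)
open import Data.Bool.Properties using (∨-zeroʳ; ∨-identityʳ; ¬-not) renaming (_≟_ to _≟B_)
open import Data.Empty using (⊥-elim)
open import Data.Fin as Fin using (Fin; zero; suc; toℕ)
open import Data.Fin.Properties using (toℕ<n; any?) renaming (_<?_ to _<ᶠ?_; ≤-refl to ≤ᶠ-refl)
open import Data.Fin.Subset using (Subset; outside; inside; _∪_; ⁅_⁆; ⊥; _∈_; _∉_; ∣_∣)
open import Data.Fin.Subset.Properties using (_∈?_; anySubset?; ∪-identityʳ; x∈⁅y⁆⇒x≡y)
open import Data.List as List using (List; []; _∷_; _++_; length; filter)
open import Data.List.Properties using (map-++; map-∘)
open import Data.List.Relation.Binary.Pointwise as Pointwise using (Pointwise; []; _∷_)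
open import Data.Nat using (ℕ; zero; suc; _+_; _*_; _≤_; _<_; z≤n; s≤s; s≤s⁻¹; _≤?_; _<?_) renaming (_≟_ to _≟ℕ_)
open import Data.Nat.Induction using (<-wellFounded)
open import Data.Nat.ListAction using (sum)
open import Data.Nat.ListAction.Properties using (sum-++)
open import Data.Nat.Properties
open import Algebra.Properties.CommutativeSemigroup +-commutativeSemigroup
  using () renaming (interchange to +-interchange; x∙yz≈y∙xz to x+[y+z]≡y+[x+z])
open import Data.Product using (_×_; _,_; proj₁; proj₂; ∃-syntax)
open import Data.Sum using (_⊎_; inj₁; inj₂)
open import Data.Vec as Vec using (Vec; []; _∷_; lookup; toList; _[_]≔_; here; there)
open import Data.Vec.Properties
  using ([]=⇒lookup; lookup⇒[]=; lookup∘tabulate; lookup-map; lookup-zipWith; lookup∘update; lookup∘update′;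
         ∷-injectiveʳ; []≔-idempotent; []≔-lookup; ≡-dec)
open import Function using (_∘_)
open import Function.Bundles using (_⇔_; mk⇔; Equivalence)
open import Induction.WellFounded using (Acc; acc)
open import Relation.Binary.Construct.Closure.ReflexiveTransitive using (ε; _◅_; _◅◅_)
open import Relation.Binary.PropositionalEquality
open import Relation.Nullary using (¬_; Dec; yes; no; does)
open import Relation.Nullary.Decidable using (_×-dec_; ¬?; dec-true; dec-false)

⟦_⟧ : Bool → ℕ
⟦ true ⟧ = 1
⟦ false ⟧ = 0

⟦∧⟧ : ∀ a b → ⟦ a ∧ b ⟧ ≡ ⟦ a ⟧ * ⟦ b ⟧
⟦∧⟧ false b = refl
⟦∧⟧ true b = sym (+-identityʳ ⟦ b ⟧)

_≟ₛ_ : ∀ {n} (S T : Subset n) → Dec (S ≡ T)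
_≟ₛ_ = ≡-dec _≟B_

∑ₛ : (n : ℕ) → (Subset n → ℕ) → ℕ
∑ₛ zero f = f []
∑ₛ (suc n) f = ∑ₛ n (f ∘ (outside ∷_)) + ∑ₛ n (f ∘ (inside ∷_))

∑ₛ-cong : ∀ n {f g : Subset n → ℕ} → (∀ S → f S ≡ g S) → ∑ₛ n f ≡ ∑ₛ n g
∑ₛ-cong zero f≡g = f≡g []
∑ₛ-cong (suc n) f≡g = cong₂ _+_ (∑ₛ-cong n (f≡g ∘ (outside ∷_))) (∑ₛ-cong n (f≡g ∘ (inside ∷_)))

∑ₛ-mono : ∀ n {f g : Subset n → ℕ} → (∀ S → f S ≤ g S) → ∑ₛ n f ≤ ∑ₛ n g
∑ₛ-mono zero f≤g = f≤g []
∑ₛ-mono (suc n) f≤g = +-mono-≤ (∑ₛ-mono n (f≤g ∘ (outside ∷_))) (∑ₛ-mono n (f≤g ∘ (inside ∷_)))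

∑ₛ-+ : ∀ n (f g : Subset n → ℕ) → ∑ₛ n (λ S → f S + g S) ≡ ∑ₛ n f + ∑ₛ n g
∑ₛ-+ zero f g = refl
∑ₛ-+ (suc n) f g = trans
  (cong₂ _+_ (∑ₛ-+ n (f ∘ (outside ∷_)) (g ∘ (outside ∷_))) (∑ₛ-+ n (f ∘ (inside ∷_)) (g ∘ (inside ∷_))))
  (+-interchange (∑ₛ n (f ∘ (outside ∷_))) (∑ₛ n (g ∘ (outside ∷_)))
                 (∑ₛ n (f ∘ (inside ∷_))) (∑ₛ n (g ∘ (inside ∷_))))

∑ₛ-zero : ∀ n {f : Subset n → ℕ} → (∀ S → f S ≡ 0) → ∑ₛ n f ≡ 0
∑ₛ-zero zero f≡0 = f≡0 []
∑ₛ-zero (suc n) f≡0 = cong₂ _+_ (∑ₛ-zero n (f≡0 ∘ (outside ∷_))) (∑ₛ-zero n (f≡0 ∘ (inside ∷_)))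

∑ₛ-single : ∀ n {f : Subset n → ℕ} S₀ → (∀ S → S ≢ S₀ → f S ≡ 0) → ∑ₛ n f ≡ f S₀
∑ₛ-single zero [] _ = refl
∑ₛ-single (suc n) (outside ∷ S₀) f≡0 =
  trans (cong₂ _+_ (∑ₛ-single n S₀ (λ S S≢S₀ → f≡0 _ (S≢S₀ ∘ ∷-injectiveʳ))) (∑ₛ-zero n (λ S → f≡0 _ λ ())))
        (+-identityʳ _)
∑ₛ-single (suc n) (inside ∷ S₀) f≡0 =
  cong₂ _+_ (∑ₛ-zero n (λ S → f≡0 _ λ ())) (∑ₛ-single n S₀ (λ S S≢S₀ → f≡0 _ (S≢S₀ ∘ ∷-injectiveʳ)))

δ : ∀ {n} → Subset n → Subset n → ℕ
δ S₀ S = ⟦ does (S ≟ₛ S₀) ⟧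

∑ₛ-δ : ∀ n S₀ (w : Subset n → ℕ) → ∑ₛ n (λ S → δ S₀ S * w S) ≡ w S₀
∑ₛ-δ n S₀ w = begin
  ∑ₛ n (λ S → δ S₀ S * w S)  ≡⟨ ∑ₛ-single n S₀ (λ S S≢S₀ → cong (λ b → ⟦ b ⟧ * w S) (dec-false (S ≟ₛ S₀) S≢S₀)) ⟩
  δ S₀ S₀ * w S₀             ≡⟨ cong (λ b → ⟦ b ⟧ * w S₀) (dec-true (S₀ ≟ₛ S₀) refl) ⟩
  1 * w S₀                   ≡⟨ *-identityˡ (w S₀) ⟩
  w S₀                       ∎
  where open ≡-Reasoning

-- (b , X) ↦ (lookup X j , X [ j ]≔ b) is a bijection of Bool × Subset n.
∑ₛ-exchange : ∀ n (j : Fin n) (g : Bool → Subset n → ℕ) →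
  ∑ₛ n (λ X → g (lookup X j) (X [ j ]≔ false)) + ∑ₛ n (λ X → g (lookup X j) (X [ j ]≔ true))
  ≡ ∑ₛ n (g false) + ∑ₛ n (g true)
∑ₛ-exchange (suc n) zero g =
  +-interchange (∑ₛ n (g false ∘ (outside ∷_))) (∑ₛ n (g true ∘ (outside ∷_)))
                (∑ₛ n (g false ∘ (inside ∷_))) (∑ₛ n (g true ∘ (inside ∷_)))
∑ₛ-exchange (suc n) (suc j) g = begin
  (L outside false + L inside false) + (L outside true + L inside true)
    ≡⟨ +-interchange (L outside false) (L inside false) (L outside true) (L inside true) ⟩
  (L outside false + L outside true) + (L inside false + L inside true)
    ≡⟨ cong₂ _+_ (∑ₛ-exchange n j (λ c Y → g c (outside ∷ Y))) (∑ₛ-exchange n j (λ c Y → g c (inside ∷ Y))) ⟩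
  (R outside false + R outside true) + (R inside false + R inside true)
    ≡⟨ +-interchange (R outside false) (R outside true) (R inside false) (R inside true) ⟩
  (R outside false + R inside false) + (R outside true + R inside true) ∎
  where
  open ≡-Reasoning
  L : Bool → Bool → ℕ
  L x b = ∑ₛ n (λ X → g (lookup X j) (x ∷ (X [ j ]≔ b)))
  R : Bool → Bool → ℕ
  R x c = ∑ₛ n (λ Y → g c (x ∷ Y))

swap : ∀ {n} → Fin n → Fin n → Subset n → Subset n
swap zero zero S = S
swap zero (suc j) (b ∷ S) = lookup S j ∷ (S [ j ]≔ b)
swap (suc i) zero (b ∷ S) = lookup S i ∷ (S [ i ]≔ b)
swap (suc i) (suc j) (b ∷ S) = b ∷ swap i j S

∑ₛ-swap : ∀ n (i j : Fin n) (f : Subset n → ℕ) → ∑ₛ n (f ∘ swap i j) ≡ ∑ₛ n f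
∑ₛ-swap (suc n) zero zero f = refl
∑ₛ-swap (suc n) zero (suc j) f = ∑ₛ-exchange n j (λ c Y → f (c ∷ Y))
∑ₛ-swap (suc n) (suc i) zero f = ∑ₛ-exchange n i (λ c Y → f (c ∷ Y))
∑ₛ-swap (suc n) (suc i) (suc j) f =
  cong₂ _+_ (∑ₛ-swap n i j (f ∘ (outside ∷_))) (∑ₛ-swap n i j (f ∘ (inside ∷_)))

lookup-swap : ∀ {n} (i j : Fin n) S → lookup (swap i j S) j ≡ lookup S i
lookup-swap zero zero S = refl
lookup-swap zero (suc j) (b ∷ S) = lookup∘update j S b
lookup-swap (suc i) zero (b ∷ S) = refl
lookup-swap (suc i) (suc j) (b ∷ S) = lookup-swap i j S

swap-id : ∀ {n} (i j : Fin n) S → lookup S i ≡ lookup S j → swap i j S ≡ S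
swap-id zero zero S _ = refl
swap-id zero (suc j) (b ∷ S) b≡Sj = cong₂ _∷_ (sym b≡Sj) (trans (cong (S [ j ]≔_) b≡Sj) ([]≔-lookup S j))
swap-id (suc i) zero (b ∷ S) Si≡b = cong₂ _∷_ Si≡b (trans (cong (S [ i ]≔_) (sym Si≡b)) ([]≔-lookup S i))
swap-id (suc i) (suc j) (b ∷ S) Si≡Sj = cong (b ∷_) (swap-id i j S Si≡Sj)

swap-move : ∀ {n} (i j : Fin n) S → lookup S i ≡ true → lookup S j ≡ false →
  swap i j S ≡ (S [ i ]≔ false) [ j ]≔ true
swap-move zero zero S Si Sj with () ← trans (sym Si) Sj
swap-move zero (suc j) (inside ∷ S) refl Sj = cong (_∷ (S [ j ]≔ true)) Sj
swap-move (suc i) zero (outside ∷ S) Si refl = cong (_∷ (S [ i ]≔ false)) Si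
swap-move (suc i) (suc j) (b ∷ S) Si Sj = cong (b ∷_) (swap-move i j S Si Sj)

length-filter≡sum : ∀ {A : Set} (p : A → Bool) xs →
  length (filter (λ x → p x ≟B true) xs) ≡ sum (List.map (⟦_⟧ ∘ p) xs)
length-filter≡sum p [] = refl
length-filter≡sum p (x ∷ xs) with p x
... | true = cong suc (length-filter≡sum p xs)
... | false = length-filter≡sum p xs

sum-map-allSubsets : ∀ n (f : Subset n → ℕ) → sum (List.map f (allSubsets n)) ≡ ∑ₛ n f
sum-map-allSubsets zero f = +-identityʳ (f [])
sum-map-allSubsets (suc n) f = begin
  sum (List.map f (List.map (outside ∷_) Ss ++ List.map (inside ∷_) Ss))
    ≡⟨ cong sum (map-++ f (List.map (outside ∷_) Ss) _) ⟩
  sum (List.map f (List.map (outside ∷_) Ss) ++ List.map f (List.map (inside ∷_) Ss))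
    ≡⟨ sum-++ (List.map f (List.map (outside ∷_) Ss)) _ ⟩
  sum (List.map f (List.map (outside ∷_) Ss)) + sum (List.map f (List.map (inside ∷_) Ss))
    ≡⟨ cong₂ _+_ (cong sum (sym (map-∘ Ss))) (cong sum (sym (map-∘ Ss))) ⟩
  sum (List.map (f ∘ (outside ∷_)) Ss) + sum (List.map (f ∘ (inside ∷_)) Ss)
    ≡⟨ cong₂ _+_ (sum-map-allSubsets n _) (sum-map-allSubsets n _) ⟩
  ∑ₛ (suc n) f ∎
  where open ≡-Reasoning
        Ss = allSubsets n

lookup-deg : ∀ {n} (K : Family n) x → lookup (deg K) x ≡ ∑ₛ n (λ S → ⟦ K S ⟧ * ⟦ lookup S x ⟧)
lookup-deg {n} K x = begin
  lookup (deg K) x                               ≡⟨ lookup∘tabulate _ x ⟩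
  length (filter _ (allSubsets n))               ≡⟨ length-filter≡sum (λ S → K S ∧ lookup S x) (allSubsets n) ⟩
  sum (List.map _ (allSubsets n))                ≡⟨ sum-map-allSubsets n _ ⟩
  ∑ₛ n (λ S → ⟦ K S ∧ lookup S x ⟧)              ≡⟨ ∑ₛ-cong n (λ S → ⟦∧⟧ (K S) (lookup S x)) ⟩
  ∑ₛ n (λ S → ⟦ K S ⟧ * ⟦ lookup S x ⟧)          ∎
  where open ≡-Reasoning

-- Partial sums, unit moves and dominance

unit : ∀ {n} → Fin n → Vec ℕ n
unit i = Vec.map ⟦_⟧ ⁅ i ⁆

-- e = d − 1ⱼ + 1ᵢ, written without truncated subtraction.
MoveUnit : ∀ {n} → Fin n → Fin n → Vec ℕ n → Vec ℕ n → Set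
MoveUnit j i d e = ∀ x → lookup e x + lookup (unit j) x ≡ lookup d x + lookup (unit i) x

psum-+ : ∀ {n} (a b c d : Vec ℕ n) → (∀ x → lookup a x + lookup b x ≡ lookup c x + lookup d x) →
  ∀ m → psum m a + psum m b ≡ psum m c + psum m d
psum-+ a b c d _ zero = refl
psum-+ [] [] [] [] _ (suc m) = refl
psum-+ (a ∷ as) (b ∷ bs) (c ∷ cs) (d ∷ ds) eq (suc m) = begin
  (a + psum m as) + (b + psum m bs)   ≡⟨ +-interchange a _ b _ ⟩
  (a + b) + (psum m as + psum m bs)   ≡⟨ cong₂ _+_ (eq zero) (psum-+ as bs cs ds (eq ∘ suc) m) ⟩
  (c + d) + (psum m cs + psum m ds)   ≡⟨ +-interchange c d _ _ ⟩
  (c + psum m cs) + (d + psum m ds)   ∎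
  where open ≡-Reasoning

sum≡psum : ∀ {n} (v : Vec ℕ n) → sumL (toList v) ≡ psum n v
sum≡psum [] = refl
sum≡psum (a ∷ v) = cong (a +_) (sum≡psum v)

psum-⊥ : ∀ {n} m → psum m (Vec.map ⟦_⟧ (⊥ {n})) ≡ 0
psum-⊥ zero = refl
psum-⊥ {zero} (suc m) = refl
psum-⊥ {suc n} (suc m) = psum-⊥ {n} m

psum-unit-< : ∀ {n} (i : Fin n) {m} → toℕ i < m → psum m (unit i) ≡ 1
psum-unit-< zero {suc m} _ = cong suc (psum-⊥ m)
psum-unit-< (suc i) {suc m} (s≤s i<m) = psum-unit-< i i<m

psum-unit-≥ : ∀ {n} (i : Fin n) {m} → m ≤ toℕ i → psum m (unit i) ≡ 0
psum-unit-≥ i {zero} _ = refl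
psum-unit-≥ (suc i) {suc m} (s≤s m≤i) = psum-unit-≥ i m≤i

psum-unit-antitone : ∀ {n} {i j : Fin n} → i Fin.≤ j → ∀ m → psum m (unit j) ≤ psum m (unit i)
psum-unit-antitone {i = i} {j} i≤j m with toℕ j <? m
... | yes j<m = ≤-reflexive (trans (psum-unit-< j j<m) (sym (psum-unit-< i (≤-<-trans i≤j j<m))))
... | no j≮m = ≤-trans (≤-reflexive (psum-unit-≥ j (≮⇒≥ j≮m))) z≤n

∑< : ℕ → (ℕ → ℕ) → ℕ
∑< zero f = 0
∑< (suc M) f = ∑< M f + f M

∑<-mono : ∀ M {f g : ℕ → ℕ} → (∀ m → f m ≤ g m) → ∑< M f ≤ ∑< M g
∑<-mono zero f≤g = z≤n
∑<-mono (suc M) f≤g = +-mono-≤ (∑<-mono M f≤g) (f≤g M)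

∑<-mono-< : ∀ M {f g : ℕ → ℕ} → (∀ m → f m ≤ g m) → ∀ {m} → m < M → f m < g m → ∑< M f < ∑< M g
∑<-mono-< (suc M) f≤g (s≤s m≤M) fm<gm with m≤n⇒m<n∨m≡n m≤M
... | inj₁ m<M = +-mono-<-≤ (∑<-mono-< M f≤g m<M fm<gm) (f≤g M)
... | inj₂ refl = +-mono-≤-< (∑<-mono M f≤g) fm<gm

potential : ∀ {n} → Vec ℕ n → ℕ
potential {n} v = ∑< n (λ m → psum m v)

module _ {n} {i j : Fin n} {d e : Vec ℕ n} (i<j : i Fin.< j) (move : MoveUnit j i d e) where

  psum-MoveUnit : ∀ m → psum m e + psum m (unit j) ≡ psum m d + psum m (unit i)
  psum-MoveUnit = psum-+ e (unit j) d (unit i) move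

  MoveUnit-psum-≤ : ∀ m → psum m d ≤ psum m e
  MoveUnit-psum-≤ m = +-cancelʳ-≤ (psum m (unit j)) _ _ (begin
    psum m d + psum m (unit j)  ≤⟨ +-monoʳ-≤ (psum m d) (psum-unit-antitone (<⇒≤ i<j) m) ⟩
    psum m d + psum m (unit i)  ≡⟨ psum-MoveUnit m ⟨
    psum m e + psum m (unit j)  ∎)
    where open ≤-Reasoning

  MoveUnit-psum-< : psum (toℕ j) d < psum (toℕ j) e
  MoveUnit-psum-< = begin-strict
    psum j′ d                    <⟨ n<1+n _ ⟩
    suc (psum j′ d)              ≡⟨ +-comm 1 _ ⟩
    psum j′ d + 1                ≡⟨ cong (psum j′ d +_) (psum-unit-< i i<j) ⟨
    psum j′ d + psum j′ (unit i) ≡⟨ psum-MoveUnit j′ ⟨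
    psum j′ e + psum j′ (unit j) ≡⟨ cong (psum j′ e +_) (psum-unit-≥ j ≤-refl) ⟩
    psum j′ e + 0                ≡⟨ +-identityʳ _ ⟩
    psum j′ e                    ∎
    where open ≤-Reasoning
          j′ = toℕ j

  MoveUnit-⊵ : e ⊵ d
  MoveUnit-⊵ = Σe≡Σd , λ m _ → MoveUnit-psum-≤ m
    where
    Σe≡Σd : sumL (toList e) ≡ sumL (toList d)
    Σe≡Σd = +-cancelʳ-≡ 1 _ _ (begin
      sumL (toList e) + 1           ≡⟨ cong₂ _+_ (sum≡psum e) (sym (psum-unit-< j (toℕ<n j))) ⟩
      psum n e + psum n (unit j)    ≡⟨ psum-MoveUnit n ⟩
      psum n d + psum n (unit i)    ≡⟨ cong₂ _+_ (sym (sum≡psum d)) (psum-unit-< i (toℕ<n i)) ⟩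
      sumL (toList d) + 1           ∎)
      where open ≡-Reasoning

  MoveUnit-⊳ : e ⊳ d
  MoveUnit-⊳ = MoveUnit-⊵ , λ e≡d → <-irrefl (cong (psum (toℕ j)) (sym e≡d)) MoveUnit-psum-<

  MoveUnit-potential-< : potential d < potential e
  MoveUnit-potential-< = ∑<-mono-< n MoveUnit-psum-≤ (toℕ<n j) MoveUnit-psum-<

MoveUnit-⊵-preserved : ∀ {n} {i j : Fin n} {d e d′ : Vec ℕ n} → i Fin.< j → MoveUnit j i e d → d ⊵ d′ →
  (∀ m → toℕ i < m → m ≤ toℕ j → psum m d′ < psum m d) → e ⊵ d′
MoveUnit-⊵-preserved {n} {i} {j} {d} {e} {d′} i<j move (Σd≡Σd′ , d′≤d) gap =
  trans (sym (proj₁ (MoveUnit-⊵ {d = e} {e = d} i<j move))) Σd≡Σd′ , d′≤e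
  where
  open ≤-Reasoning
  psum-d : ∀ m → psum m d + psum m (unit j) ≡ psum m e + psum m (unit i)
  psum-d = psum-MoveUnit i<j move
  psum-d≡e : ∀ m {c} → psum m (unit j) ≡ c → psum m (unit i) ≡ c → psum m d ≡ psum m e
  psum-d≡e m uj≡c ui≡c = +-cancelʳ-≡ _ _ _ (begin-equality
    psum m d + _                ≡⟨ cong (psum m d +_) uj≡c ⟨
    psum m d + psum m (unit j)  ≡⟨ psum-d m ⟩
    psum m e + psum m (unit i)  ≡⟨ cong (psum m e +_) ui≡c ⟩
    psum m e + _                ∎)
  d′≤e : ∀ m → m ≤ n → psum m d′ ≤ psum m e
  d′≤e m m≤n with toℕ i <? m | m ≤? toℕ j
  ... | no i≮m | _ = ≤-trans (d′≤d m m≤n)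
    (≤-reflexive (psum-d≡e m (psum-unit-≥ j (≤-trans (≮⇒≥ i≮m) (<⇒≤ i<j))) (psum-unit-≥ i (≮⇒≥ i≮m))))
  ... | yes i<m | no m≰j = ≤-trans (d′≤d m m≤n)
    (≤-reflexive (psum-d≡e m (psum-unit-< j (≰⇒> m≰j)) (psum-unit-< i i<m)))
  ... | yes i<m | yes m≤j = +-cancelʳ-≤ 1 _ _ (begin
    psum m d′ + 1               ≡⟨ +-comm _ 1 ⟩
    suc (psum m d′)             ≤⟨ gap m i<m m≤j ⟩
    psum m d                    ≡⟨ +-identityʳ _ ⟨
    psum m d + 0                ≡⟨ cong (psum m d +_) (psum-unit-≥ j m≤j) ⟨
    psum m d + psum m (unit j)  ≡⟨ psum-d m ⟩
    psum m e + psum m (unit i)  ≡⟨ cong (psum m e +_) (psum-unit-< i i<m) ⟩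
    psum m e + 1                ∎)

-- While t stays ≥ A > B ≥ u, the surplus p − q of t over u can only grow; as the totals agree,
-- t must drop below A somewhere.
surplus-until-drop : ∀ {n} (t u : Vec ℕ n) {p q A B : ℕ} → q < p → p + sumL (toList t) ≡ q + sumL (toList u) →
  (∀ x → lookup u x ≤ B) → B < A →
  ∃[ j ] lookup t j < A × (∀ m → m ≤ toℕ j → q + psum m u < p + psum m t)
surplus-until-drop [] [] {p} {q} q<p Σ≡ _ _ =
  ⊥-elim (<-irrefl (sym (trans (sym (+-identityʳ p)) (trans Σ≡ (+-identityʳ q)))) q<p)
surplus-until-drop (c ∷ t) (c′ ∷ u) {p} {q} {A} {B} q<p Σ≡ u≤B B<A with c <? A
... | yes c<A = zero , c<A , λ { zero _ → +-mono-<-≤ q<p z≤n }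
... | no c≮A =
  let j , tj<A , surplus = surplus-until-drop t u q+c′<p+c Σ≡′ (u≤B ∘ suc) B<A
  in suc j , tj<A , λ { zero _ → +-mono-<-≤ q<p z≤n
                      ; (suc m) (s≤s m≤j) → subst₂ _<_ (+-assoc q c′ _) (+-assoc p c _) (surplus m m≤j) }
  where
  q+c′<p+c : q + c′ < p + c
  q+c′<p+c = +-mono-<-≤ q<p (≤-trans (u≤B zero) (≤-trans (<⇒≤ B<A) (≮⇒≥ c≮A)))
  Σ≡′ : (p + c) + sumL (toList t) ≡ (q + c′) + sumL (toList u)
  Σ≡′ = trans (+-assoc p c _) (trans Σ≡ (sym (+-assoc q c′ _)))

dominance-gap : ∀ {n} (d e : Vec ℕ n) → WeaklyDecreasing e → d ⊵ e → d ≢ e →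
  ∃[ i ] ∃[ j ] i Fin.< j × lookup d j < lookup d i × (∀ m → toℕ i < m → m ≤ toℕ j → psum m e < psum m d)
dominance-gap [] [] _ _ d≢e = ⊥-elim (d≢e refl)
dominance-gap (a ∷ t) (b ∷ u) e↓ (Σ≡ , e≤d) d≢e
  with m≤n⇒m<n∨m≡n (subst₂ _≤_ (+-identityʳ b) (+-identityʳ a) (e≤d 1 (s≤s z≤n)))
... | inj₁ b<a =
  let j , tj<a , surplus = surplus-until-drop t u b<a Σ≡ (λ x → e↓ zero (suc x) z≤n) b<a
  in zero , suc j , s≤s z≤n , tj<a , λ { (suc m) _ (s≤s m≤j) → surplus m m≤j }
... | inj₂ refl =
  let i , j , i<j , tj<ti , gap = dominance-gap t u (λ x y x≤y → e↓ (suc x) (suc y) (s≤s x≤y))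
                                    (+-cancelˡ-≡ b _ _ Σ≡ , λ m m≤n → +-cancelˡ-≤ b _ _ (e≤d (suc m) (s≤s m≤n)))
                                    (d≢e ∘ cong (b ∷_))
  in suc i , suc j , s≤s i<j , tj<ti , λ { (suc m) (s≤s i<m) (s≤s m≤j) → +-monoʳ-< b (gap m i<m m≤j) }

-- Subsets of Fin n and the componentwise order

outside⇒∉ : ∀ {n} {i : Fin n} {A : Subset n} → lookup A i ≡ false → i ∉ A
outside⇒∉ Ai≡false i∈A with () ← trans (sym ([]=⇒lookup i∈A)) Ai≡false

∉-∷⁺ : ∀ {n} {i : Fin n} {A : Subset n} {b} → i ∉ A → suc i ∉ b ∷ A
∉-∷⁺ i∉A (there i∈A) = i∉A i∈A

∪⁅⁆≡[]≔true : ∀ {n} (A : Subset n) i → A ∪ ⁅ i ⁆ ≡ A [ i ]≔ true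
∪⁅⁆≡[]≔true (b ∷ A) zero = cong₂ _∷_ (∨-zeroʳ b) (∪-identityʳ A)
∪⁅⁆≡[]≔true (b ∷ A) (suc i) = cong₂ _∷_ (∨-identityʳ b) (∪⁅⁆≡[]≔true A i)

∣∪⁅⁆∣ : ∀ {n} (A : Subset n) i → i ∉ A → ∣ A ∪ ⁅ i ⁆ ∣ ≡ suc ∣ A ∣
∣∪⁅⁆∣ (inside ∷ A) zero i∉A = ⊥-elim (i∉A here)
∣∪⁅⁆∣ (outside ∷ A) zero _ = cong (suc ∘ ∣_∣) (∪-identityʳ A)
∣∪⁅⁆∣ (inside ∷ A) (suc i) i∉A = cong suc (∣∪⁅⁆∣ A i (i∉A ∘ there))
∣∪⁅⁆∣ (outside ∷ A) (suc i) i∉A = ∣∪⁅⁆∣ A i (i∉A ∘ there)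

⟦∨⟧ : ∀ {a b} → (a ≡ true → b ≡ false) → ⟦ a ∨ b ⟧ ≡ ⟦ a ⟧ + ⟦ b ⟧
⟦∨⟧ {false} _ = refl
⟦∨⟧ {true} a→¬b rewrite a→¬b refl = refl

⟦lookup-∪⁅⁆⟧ : ∀ {n} {A : Subset n} {j} → j ∉ A → ∀ x →
  ⟦ lookup (A ∪ ⁅ j ⁆) x ⟧ ≡ ⟦ lookup A x ⟧ + lookup (unit j) x
⟦lookup-∪⁅⁆⟧ {A = A} {j} j∉A x = begin
  ⟦ lookup (A ∪ ⁅ j ⁆) x ⟧             ≡⟨ cong ⟦_⟧ (lookup-zipWith _∨_ x A ⁅ j ⁆) ⟩
  ⟦ lookup A x ∨ lookup ⁅ j ⁆ x ⟧      ≡⟨ ⟦∨⟧ disjoint ⟩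
  ⟦ lookup A x ⟧ + ⟦ lookup ⁅ j ⁆ x ⟧  ≡⟨ cong (⟦ lookup A x ⟧ +_) (lookup-map x ⟦_⟧ ⁅ j ⁆) ⟨
  ⟦ lookup A x ⟧ + lookup (unit j) x   ∎
  where
  open ≡-Reasoning
  disjoint : lookup A x ≡ true → lookup ⁅ j ⁆ x ≡ false
  disjoint Ax = ¬-not λ ⁅j⁆x →
    j∉A (subst (_∈ A) (x∈⁅y⁆⇒x≡y j (lookup⇒[]= x ⁅ j ⁆ ⁅j⁆x)) (lookup⇒[]= x A Ax))

Pointwise-suc⁺ : ∀ {n} {xs ys : List (Fin n)} →
  Pointwise Fin._≤_ xs ys → Pointwise Fin._≤_ (List.map suc xs) (List.map suc ys)
Pointwise-suc⁺ = Pointwise.map⁺ suc suc ∘ Pointwise.map s≤s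

Pointwise-suc⁻ : ∀ {n} {xs ys : List (Fin n)} →
  Pointwise Fin._≤_ (List.map suc xs) (List.map suc ys) → Pointwise Fin._≤_ xs ys
Pointwise-suc⁻ = Pointwise.map s≤s⁻¹ ∘ Pointwise.map⁻ suc suc

Pointwise-zero-head : ∀ {n} {x : Fin (suc n)} {xs ys : List (Fin (suc n))} →
  Pointwise Fin._≤_ (x ∷ xs) ys → Pointwise Fin._≤_ (zero ∷ xs) ys
Pointwise-zero-head (_ ∷ rest) = z≤n ∷ rest

inside∷-≤c : ∀ {n} (B : Subset n) y → y ∉ B → (inside ∷ B) ≤c (outside ∷ (B ∪ ⁅ y ⁆))
inside∷-≤c (inside ∷ B) zero y∉B = ⊥-elim (y∉B here)
inside∷-≤c (outside ∷ B) zero _ rewrite ∪-identityʳ B = z≤n ∷ Pointwise.refl ≤ᶠ-refl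
inside∷-≤c (inside ∷ B) (suc y) y∉B = z≤n ∷ Pointwise-suc⁺ (inside∷-≤c B y (y∉B ∘ there))
inside∷-≤c (outside ∷ B) (suc y) y∉B = Pointwise-zero-head (Pointwise-suc⁺ (inside∷-≤c B y (y∉B ∘ there)))

∪⁅⁆-≤c : ∀ {n} (A : Subset n) {i j} → i Fin.< j → i ∉ A → j ∉ A → (A ∪ ⁅ i ⁆) ≤c (A ∪ ⁅ j ⁆)
∪⁅⁆-≤c (inside ∷ A) {zero} _ i∉A _ = ⊥-elim (i∉A here)
∪⁅⁆-≤c (outside ∷ A) {zero} {suc j} _ _ j∉A rewrite ∪-identityʳ A = inside∷-≤c A j (j∉A ∘ there)
∪⁅⁆-≤c (inside ∷ A) {suc i} {suc j} (s≤s i<j) i∉A j∉A =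
  z≤n ∷ Pointwise-suc⁺ (∪⁅⁆-≤c A i<j (i∉A ∘ there) (j∉A ∘ there))
∪⁅⁆-≤c (outside ∷ A) {suc i} {suc j} (s≤s i<j) i∉A j∉A =
  Pointwise-suc⁺ (∪⁅⁆-≤c A i<j (i∉A ∘ there) (j∉A ∘ there))

elems-∷-view : ∀ {n} (T : Subset n) {y rest} → elems T ≡ y ∷ rest →
  ∃[ D ] y ∉ D × D ∪ ⁅ y ⁆ ≡ T × elems D ≡ rest
elems-∷-view (inside ∷ X) refl = outside ∷ X , (λ ()) , cong (inside ∷_) (∪-identityʳ X) , refl
elems-∷-view (outside ∷ X) eq with elems X in elemsX
elems-∷-view (outside ∷ X) () | []
elems-∷-view (outside ∷ X) refl | y ∷ rest =
  let D , y∉D , D∪y≡X , elemsD = elems-∷-view X elemsX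
  in outside ∷ D , ∉-∷⁺ y∉D , cong (outside ∷_) D∪y≡X , cong (List.map suc) elemsD

Replaces : ∀ {n} → Family n → Family n → Subset n → Subset n → Set
Replaces K K′ Sout Sin = ∀ S → S ∈F K′ ⇔ ((S ∈F K × S ≢ Sout) ⊎ S ≡ Sin)

Replaces-intro : ∀ {n} {K K′ : Family n} {Sout Sin} → Sin ∈F K′ → Sout ∉F K′ →
  (∀ S → S ≢ Sin → S ≢ Sout → K′ S ≡ K S) → Replaces K K′ Sout Sin
Replaces-intro {K = K} {K′} {Sout} {Sin} Sin∈K′ Sout∉K′ K′≡K S = mk⇔ to from
  where
  to : S ∈F K′ → (S ∈F K × S ≢ Sout) ⊎ S ≡ Sin
  to S∈K′ with S ≟ₛ Sin | S ≟ₛ Sout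
  ... | yes S≡Sin | _ = inj₂ S≡Sin
  ... | no _ | yes S≡Sout with () ← trans (sym S∈K′) (trans (cong K′ S≡Sout) Sout∉K′)
  ... | no S≢Sin | no S≢Sout = inj₁ (trans (sym (K′≡K S S≢Sin S≢Sout)) S∈K′ , S≢Sout)
  from : (S ∈F K × S ≢ Sout) ⊎ S ≡ Sin → S ∈F K′
  from (inj₂ S≡Sin) = trans (cong K′ S≡Sin) Sin∈K′
  from (inj₁ (S∈K , S≢Sout)) with S ≟ₛ Sin
  ... | yes S≡Sin = trans (cong K′ S≡Sin) Sin∈K′
  ... | no S≢Sin = trans (K′≡K S S≢Sin S≢Sout) S∈K

∈∉⇒≢ : ∀ {n} {K : Family n} {S T} → S ∈F K → T ∉F K → T ≢ S
∈∉⇒≢ S∈K T∉K refl with () ← trans (sym S∈K) T∉K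

module _ {n} {K K′ : Family n} {Sout Sin : Subset n} (rep : Replaces K K′ Sout Sin) where

  Replaces-in : Sin ∈F K′
  Replaces-in = Equivalence.from (rep Sin) (inj₂ refl)

  Replaces-out : Sin ≢ Sout → Sout ∉F K′
  Replaces-out Sin≢Sout with K′ Sout in K′Sout
  ... | false = refl
  ... | true with Equivalence.to (rep Sout) K′Sout
  ...   | inj₁ (_ , Sout≢Sout) = ⊥-elim (Sout≢Sout refl)
  ...   | inj₂ Sout≡Sin = ⊥-elim (Sin≢Sout (sym Sout≡Sin))

  Replaces-other : ∀ {S} → S ≢ Sin → S ≢ Sout → K′ S ≡ K S
  Replaces-other {S} S≢Sin S≢Sout with K′ S in K′S | K S in KS
  ... | false | false = refl
  ... | true | true = refl
  ... | false | true with () ← trans (sym (Equivalence.from (rep S) (inj₁ (KS , S≢Sout)))) K′S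
  ... | true | false with Equivalence.to (rep S) K′S
  ...   | inj₁ (S∈K , _) with () ← trans (sym S∈K) KS
  ...   | inj₂ S≡Sin = ⊥-elim (S≢Sin S≡Sin)

  Replaces-sym : Sout ∈F K → Sin ∉F K → Replaces K′ K Sin Sout
  Replaces-sym Sout∈K Sin∉K =
    Replaces-intro Sout∈K Sin∉K λ S S≢Sout S≢Sin → sym (Replaces-other S≢Sin S≢Sout)

  module _ (Sout∈K : Sout ∈F K) (Sin∉K : Sin ∉F K) where

    indicator-Replaces : ∀ S → ⟦ K′ S ⟧ + δ Sout S ≡ ⟦ K S ⟧ + δ Sin S
    indicator-Replaces S with S ≟ₛ Sin | S ≟ₛ Sout
    ... | yes S≡Sin | yes S≡Sout = ⊥-elim (∈∉⇒≢ Sout∈K Sin∉K (trans (sym S≡Sin) S≡Sout))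
    ... | yes S≡Sin | no _
      rewrite trans (cong K′ S≡Sin) Replaces-in | trans (cong K S≡Sin) Sin∉K = refl
    ... | no S≢Sin | yes S≡Sout
      rewrite trans (cong K′ S≡Sout) (Replaces-out (∈∉⇒≢ Sout∈K Sin∉K)) | trans (cong K S≡Sout) Sout∈K = refl
    ... | no S≢Sin | no S≢Sout = cong (λ b → ⟦ b ⟧ + 0) (Replaces-other S≢Sin S≢Sout)

    ∑ₛ-Replaces : ∀ (w : Subset n → ℕ) →
      ∑ₛ n (λ S → ⟦ K′ S ⟧ * w S) + w Sout ≡ ∑ₛ n (λ S → ⟦ K S ⟧ * w S) + w Sin
    ∑ₛ-Replaces w = begin
      ∑ₛ n (λ S → ⟦ K′ S ⟧ * w S) + w Sout
        ≡⟨ cong (∑ₛ n (λ S → ⟦ K′ S ⟧ * w S) +_) (∑ₛ-δ n Sout w) ⟨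
      ∑ₛ n (λ S → ⟦ K′ S ⟧ * w S) + ∑ₛ n (λ S → δ Sout S * w S)
        ≡⟨ ∑ₛ-+ n _ _ ⟨
      ∑ₛ n (λ S → ⟦ K′ S ⟧ * w S + δ Sout S * w S)
        ≡⟨ ∑ₛ-cong n pointwise ⟩
      ∑ₛ n (λ S → ⟦ K S ⟧ * w S + δ Sin S * w S)
        ≡⟨ ∑ₛ-+ n _ _ ⟩
      ∑ₛ n (λ S → ⟦ K S ⟧ * w S) + ∑ₛ n (λ S → δ Sin S * w S)
        ≡⟨ cong (∑ₛ n (λ S → ⟦ K S ⟧ * w S) +_) (∑ₛ-δ n Sin w) ⟩
      ∑ₛ n (λ S → ⟦ K S ⟧ * w S) + w Sin ∎
      where
      open ≡-Reasoning
      pointwise : ∀ S → ⟦ K′ S ⟧ * w S + δ Sout S * w S ≡ ⟦ K S ⟧ * w S + δ Sin S * w S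
      pointwise S = trans (sym (*-distribʳ-+ (w S) ⟦ K′ S ⟧ (δ Sout S)))
                          (trans (cong (_* w S) (indicator-Replaces S)) (*-distribʳ-+ (w S) ⟦ K S ⟧ (δ Sin S)))

    deg-Replaces : ∀ x → lookup (deg K′) x + ⟦ lookup Sout x ⟧ ≡ lookup (deg K) x + ⟦ lookup Sin x ⟧
    deg-Replaces x rewrite lookup-deg K′ x | lookup-deg K x = ∑ₛ-Replaces (λ S → ⟦ lookup S x ⟧)

  IsKFamily-Replaces : ∀ {k} → IsKFamily k K → ∣ Sin ∣ ≡ k → IsKFamily k K′
  IsKFamily-Replaces isK ∣Sin∣≡k S S∈K′ with Equivalence.to (rep S) S∈K′
  ... | inj₁ (S∈K , _) = isK S S∈K
  ... | inj₂ refl = ∣Sin∣≡k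

replace : ∀ {n} → Family n → Subset n → Subset n → Family n
replace K Sout Sin S = does (S ≟ₛ Sin) ∨ (not (does (S ≟ₛ Sout)) ∧ K S)

replace-Replaces : ∀ {n} (K : Family n) {Sout Sin} → Sin ≢ Sout → Replaces K (replace K Sout Sin) Sout Sin
replace-Replaces K {Sout} {Sin} Sin≢Sout = Replaces-intro
  (cong (_∨ (not (does (Sin ≟ₛ Sout)) ∧ K Sin)) (dec-true (Sin ≟ₛ Sin) refl))
  (cong₂ (λ a b → a ∨ (not b ∧ K Sout)) (dec-false (Sout ≟ₛ Sin) (Sin≢Sout ∘ sym)) (dec-true (Sout ≟ₛ Sout) refl))
  (λ S S≢Sin S≢Sout → cong₂ (λ a b → a ∨ (not b ∧ K S)) (dec-false (S ≟ₛ Sin) S≢Sin) (dec-false (S ≟ₛ Sout) S≢Sout))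

-- Swings and shifted families

SwingSite : ∀ {n} → ℕ → Family n → Fin n → Fin n → Subset n → Set
SwingSite k K i j A = i Fin.< j × suc ∣ A ∣ ≡ k × i ∉ A × j ∉ A × (A ∪ ⁅ j ⁆) ∈F K × (A ∪ ⁅ i ⁆) ∉F K

swing-at : ∀ {n k} {K : Family n} {i j A} → SwingSite k K i j A → Swing k K (replace K (A ∪ ⁅ j ⁆) (A ∪ ⁅ i ⁆))
swing-at {K = K} {i} {j} {A} (i<j , ∣A∣ , i∉A , j∉A , Aj∈K , Ai∉K) =
  i , j , A , i<j , ∣A∣ , i∉A , j∉A , Aj∈K , Ai∉K , replace-Replaces K (∈∉⇒≢ {K = K} Aj∈K Ai∉K)

MoveUnit-swing : ∀ {n} {K K′ : Family n} {i j A} → i ∉ A → j ∉ A → (A ∪ ⁅ j ⁆) ∈F K → (A ∪ ⁅ i ⁆) ∉F K →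
  Replaces K K′ (A ∪ ⁅ j ⁆) (A ∪ ⁅ i ⁆) → MoveUnit j i (deg K) (deg K′)
MoveUnit-swing {K = K} {K′} {i} {j} {A} i∉A j∉A Aj∈K Ai∉K rep x = +-cancelˡ-≡ a (d′ + uj) (d + ui) (begin
  a + (d′ + uj)                  ≡⟨ x+[y+z]≡y+[x+z] a d′ uj ⟩
  d′ + (a + uj)                  ≡⟨ cong (d′ +_) (⟦lookup-∪⁅⁆⟧ {A = A} j∉A x) ⟨
  d′ + ⟦ lookup (A ∪ ⁅ j ⁆) x ⟧  ≡⟨ deg-Replaces {K = K} rep Aj∈K Ai∉K x ⟩
  d + ⟦ lookup (A ∪ ⁅ i ⁆) x ⟧   ≡⟨ cong (d +_) (⟦lookup-∪⁅⁆⟧ {A = A} i∉A x) ⟩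
  d + (a + ui)                   ≡⟨ x+[y+z]≡y+[x+z] d a ui ⟩
  a + (d + ui)                   ∎)
  where
  open ≡-Reasoning
  a = ⟦ lookup A x ⟧
  d = lookup (deg K) x
  d′ = lookup (deg K′) x
  ui = lookup (unit i) x
  uj = lookup (unit j) x

swing-⊳ : ∀ {n k} {K K′ : Family n} → Swing k K K′ → deg K′ ⊳ deg K
swing-⊳ {K = K} {K′} (i , j , A , i<j , _ , i∉A , j∉A , Aj∈K , Ai∉K , rep) =
  MoveUnit-⊳ i<j (MoveUnit-swing {K = K} {K′} i∉A j∉A Aj∈K Ai∉K rep)

LeftShiftClosed : ∀ {n} → ℕ → Family n → Set
LeftShiftClosed {n} k K = ∀ {i j : Fin n} {A} → i Fin.< j → suc ∣ A ∣ ≡ k → i ∉ A → j ∉ A →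
  (A ∪ ⁅ j ⁆) ∈F K → (A ∪ ⁅ i ⁆) ∈F K

Shifted⇒LeftShiftClosed : ∀ {n k} {K : Family n} → Shifted k K → LeftShiftClosed k K
Shifted⇒LeftShiftClosed shifted {i} {j} {A} i<j ∣A∣ i∉A j∉A Aj∈K =
  shifted (A ∪ ⁅ i ⁆) (A ∪ ⁅ j ⁆) (trans (∣∪⁅⁆∣ A i i∉A) ∣A∣) (trans (∣∪⁅⁆∣ A j j∉A) ∣A∣) Aj∈K
    (∪⁅⁆-≤c A i<j i∉A j∉A)

LeftShiftClosed-outside∷ : ∀ {n k} {K : Family (suc n)} →
  LeftShiftClosed k K → LeftShiftClosed k (K ∘ (outside ∷_))
LeftShiftClosed-outside∷ closed {i} {j} {A} i<j ∣A∣ i∉A j∉A =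
  closed {suc i} {suc j} {outside ∷ A} (s≤s i<j) ∣A∣ (∉-∷⁺ i∉A) (∉-∷⁺ j∉A)

LeftShiftClosed-inside∷ : ∀ {n k} {K : Family (suc n)} →
  LeftShiftClosed (suc k) K → LeftShiftClosed k (K ∘ (inside ∷_))
LeftShiftClosed-inside∷ closed {i} {j} {A} i<j ∣A∣ i∉A j∉A =
  closed {suc i} {suc j} {inside ∷ A} (s≤s i<j) (cong suc ∣A∣) (∉-∷⁺ i∉A) (∉-∷⁺ j∉A)

¬map-suc≤zero∷ : ∀ {n} {xs : List (Fin n)} {ys : List (Fin (suc n))} →
  ¬ Pointwise Fin._≤_ (List.map suc xs) (zero ∷ ys)
¬map-suc≤zero∷ {xs = []} ()
¬map-suc≤zero∷ {xs = _ ∷ _} (() ∷ _)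

LeftShiftClosed⇒≤c-closed : ∀ n {k} (K : Family n) → LeftShiftClosed k K →
  ∀ S T → ∣ T ∣ ≡ k → T ∈F K → S ≤c T → S ∈F K
LeftShiftClosed⇒≤c-closed zero K _ [] [] _ T∈K _ = T∈K
LeftShiftClosed⇒≤c-closed (suc n) K closed (outside ∷ S) (outside ∷ T) ∣T∣ T∈K S≤T =
  LeftShiftClosed⇒≤c-closed n (K ∘ (outside ∷_)) (LeftShiftClosed-outside∷ {K = K} closed)
    S T ∣T∣ T∈K (Pointwise-suc⁻ S≤T)
LeftShiftClosed⇒≤c-closed (suc n) K closed (inside ∷ S) (inside ∷ T) refl T∈K (_ ∷ S≤T) =
  LeftShiftClosed⇒≤c-closed n (K ∘ (inside ∷_)) (LeftShiftClosed-inside∷ {K = K} closed)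
    S T refl T∈K (Pointwise-suc⁻ S≤T)
LeftShiftClosed⇒≤c-closed (suc n) K closed (outside ∷ S) (inside ∷ T) _ _ S≤T = ⊥-elim (¬map-suc≤zero∷ S≤T)
LeftShiftClosed⇒≤c-closed (suc n) {k} K closed (inside ∷ S) (outside ∷ T) ∣T∣ T∈K S≤T with elems T in elemsT
... | [] with () ← S≤T
... | y ∷ rest with _ ∷ S≤rest ← S≤T | D , y∉D , D∪y≡T , elemsD ← elems-∷-view T elemsT =
  LeftShiftClosed⇒≤c-closed n (K ∘ (inside ∷_)) (LeftShiftClosed-inside∷ {K = K} closed′) S D refl inside∷D∈K
    (subst (Pointwise Fin._≤_ (elems S)) (sym elemsD) (Pointwise-suc⁻ S≤rest))
  where
  ∣D∣ : suc ∣ D ∣ ≡ k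
  ∣D∣ = trans (sym (∣∪⁅⁆∣ D y y∉D)) (trans (cong ∣_∣ D∪y≡T) ∣T∣)
  closed′ : LeftShiftClosed (suc ∣ D ∣) K
  closed′ = subst (λ k′ → LeftShiftClosed k′ K) (sym ∣D∣) closed
  -- closedness moves y = min T down to 0
  inside∷D∈K : (inside ∷ D) ∈F K
  inside∷D∈K = subst (λ X → (inside ∷ X) ∈F K) (∪-identityʳ D)
    (closed {zero} {suc y} {outside ∷ D} (s≤s z≤n) ∣D∣ (λ ()) (∉-∷⁺ y∉D)
      (subst (λ X → (outside ∷ X) ∈F K) (sym D∪y≡T) T∈K))

swingSite? : ∀ {n} k (K : Family n) → Dec (∃[ i ] ∃[ j ] ∃[ A ] SwingSite k K i j A)
swingSite? k K = any? λ i → any? λ j → anySubset? λ A →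
  (i <ᶠ? j) ×-dec (suc ∣ A ∣ ≟ℕ k) ×-dec ¬? (i ∈? A) ×-dec ¬? (j ∈? A)
    ×-dec (K (A ∪ ⁅ j ⁆) ≟B true) ×-dec (K (A ∪ ⁅ i ⁆) ≟B false)

¬SwingSite⇒LeftShiftClosed : ∀ {n k} {K : Family n} →
  ¬ (∃[ i ] ∃[ j ] ∃[ A ] SwingSite k K i j A) → LeftShiftClosed k K
¬SwingSite⇒LeftShiftClosed {K = K} ¬site {i} {j} {A} i<j ∣A∣ i∉A j∉A Aj∈K with K (A ∪ ⁅ i ⁆) in Ai
... | true = refl
... | false = ⊥-elim (¬site (i , j , A , i<j , ∣A∣ , i∉A , j∉A , Aj∈K , Ai))

CanSwing⇔¬Shifted : ∀ {n} k (K : Family n) → CanSwing k K ⇔ (¬ Shifted k K)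
CanSwing⇔¬Shifted {n} k K = mk⇔ to from
  where
  to : CanSwing k K → ¬ Shifted k K
  to (_ , i , j , A , i<j , ∣A∣ , i∉A , j∉A , Aj∈K , Ai∉K , _) shifted
    with () ← trans (sym (Shifted⇒LeftShiftClosed {K = K} shifted i<j ∣A∣ i∉A j∉A Aj∈K)) Ai∉K
  from : ¬ Shifted k K → CanSwing k K
  from ¬shifted with swingSite? k K
  ... | yes (_ , _ , _ , site) = _ , swing-at site
  ... | no ¬site = ⊥-elim (¬shifted λ S T _ →
    LeftShiftClosed⇒≤c-closed n K (¬SwingSite⇒LeftShiftClosed {K = K} ¬site) S T)

-- Reaching a dominated degree sequence by reverse swings

deg-≤-swap-closed : ∀ {n} (K : Family n) (i j : Fin n) →
  (∀ S → S ∈F K → lookup S i ≡ true → swap i j S ∈F K) → lookup (deg K) i ≤ lookup (deg K) j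
deg-≤-swap-closed {n} K i j closed = begin
  lookup (deg K) i                        ≡⟨ lookup-deg K i ⟩
  ∑ₛ n (λ S → ⟦ K S ⟧ * ⟦ lookup S i ⟧)   ≤⟨ ∑ₛ-mono n pointwise ⟩
  ∑ₛ n (count-j ∘ swap i j)               ≡⟨ ∑ₛ-swap n i j count-j ⟩
  ∑ₛ n count-j                            ≡⟨ lookup-deg K j ⟨
  lookup (deg K) j                        ∎
  where
  open ≤-Reasoning
  count-j : Subset n → ℕ
  count-j S = ⟦ K S ⟧ * ⟦ lookup S j ⟧
  pointwise : ∀ S → ⟦ K S ⟧ * ⟦ lookup S i ⟧ ≤ ⟦ K (swap i j S) ⟧ * ⟦ lookup (swap i j S) j ⟧
  pointwise S with K S in KS | lookup S i in Si
  ... | false | _ = z≤n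
  ... | true | false = z≤n
  ... | true | true rewrite closed S KS Si | lookup-swap i j S | Si = ≤-refl

-- A witness S ∈ K with i ∈ S and swap i j S ∉ K cannot contain j, as swap i j fixes such sets.
swing-site-from-deg : ∀ {n} (K : Family n) {i j} → lookup (deg K) j < lookup (deg K) i →
  ∃[ A ] i ∉ A × j ∉ A × (A ∪ ⁅ i ⁆) ∈F K × (A ∪ ⁅ j ⁆) ∉F K
swing-site-from-deg K {i} {j} dj<di
  with anySubset? (λ S → (K S ≟B true) ×-dec (lookup S i ≟B true) ×-dec (K (swap i j S) ≟B false))
... | no ¬witness = ⊥-elim (<⇒≱ dj<di (deg-≤-swap-closed K i j closed))
  where
  closed : ∀ S → S ∈F K → lookup S i ≡ true → swap i j S ∈F K
  closed S S∈K Si = ¬-not λ swapS∉K → ¬witness (S , S∈K , Si , swapS∉K)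
... | yes (S , S∈K , Si , swapS∉K) =
  A , outside⇒∉ (lookup∘update i S false) , outside⇒∉ (trans (lookup∘update′ (i≢j ∘ sym) S false) Sj) ,
  subst (_∈F K) (sym A∪i≡S) S∈K , subst (_∉F K) (sym A∪j≡swapS) swapS∉K
  where
  Sj : lookup S j ≡ false
  Sj = ¬-not λ Sj≡true → true≢false
    (trans (sym S∈K) (trans (cong K (sym (swap-id i j S (trans Si (sym Sj≡true))))) swapS∉K))
    where true≢false : true ≢ false
          true≢false ()
  i≢j : i ≢ j
  i≢j i≡j with () ← trans (sym Si) (trans (cong (lookup S) i≡j) Sj)
  A = S [ i ]≔ false
  A∪i≡S : A ∪ ⁅ i ⁆ ≡ S
  A∪i≡S = begin
    A ∪ ⁅ i ⁆           ≡⟨ ∪⁅⁆≡[]≔true A i ⟩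
    A [ i ]≔ true       ≡⟨ []≔-idempotent S i ⟩
    S [ i ]≔ true       ≡⟨ cong (S [ i ]≔_) Si ⟨
    S [ i ]≔ lookup S i ≡⟨ []≔-lookup S i ⟩
    S                   ∎
    where open ≡-Reasoning
  A∪j≡swapS : A ∪ ⁅ j ⁆ ≡ swap i j S
  A∪j≡swapS = trans (∪⁅⁆≡[]≔true A j) (sym (swap-move i j S Si Sj))

reverse-swing : ∀ {n k} {K : Family n} {i j : Fin n} → IsKFamily k K → i Fin.< j →
  lookup (deg K) j < lookup (deg K) i → ∃[ K′ ] IsKFamily k K′ × Swing k K′ K × MoveUnit j i (deg K′) (deg K)
reverse-swing {k = k} {K} {i} {j} isK i<j dj<di with swing-site-from-deg K dj<di
... | A , i∉A , j∉A , Ai∈K , Aj∉K =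
  K′ , IsKFamily-Replaces {K = K} rep isK (trans (∣∪⁅⁆∣ A j j∉A) ∣A∣) ,
  (i , j , A , i<j , ∣A∣ , i∉A , j∉A , Aj∈K′ , Ai∉K′ , rep⁻¹) ,
  MoveUnit-swing {K = K′} {K} i∉A j∉A Aj∈K′ Ai∉K′ rep⁻¹
  where
  K′ = replace K (A ∪ ⁅ i ⁆) (A ∪ ⁅ j ⁆)
  Aj≢Ai : A ∪ ⁅ j ⁆ ≢ A ∪ ⁅ i ⁆
  Aj≢Ai = ∈∉⇒≢ {K = K} Ai∈K Aj∉K
  rep : Replaces K K′ (A ∪ ⁅ i ⁆) (A ∪ ⁅ j ⁆)
  rep = replace-Replaces K Aj≢Ai
  rep⁻¹ : Replaces K′ K (A ∪ ⁅ j ⁆) (A ∪ ⁅ i ⁆)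
  rep⁻¹ = Replaces-sym {K = K} rep Ai∈K Aj∉K
  ∣A∣ : suc ∣ A ∣ ≡ k
  ∣A∣ = trans (sym (∣∪⁅⁆∣ A i i∉A)) (isK _ Ai∈K)
  Aj∈K′ : (A ∪ ⁅ j ⁆) ∈F K′
  Aj∈K′ = Replaces-in {K = K} rep
  Ai∉K′ : (A ∪ ⁅ i ⁆) ∉F K′
  Ai∉K′ = Replaces-out {K = K} rep Aj≢Ai

module _ {n k : ℕ} {d′ : Vec ℕ n} (d′↓ : WeaklyDecreasing d′) where

  swings-to-degree : ∀ (K : Family n) → Acc _<_ (potential (deg K)) → IsKFamily k K → deg K ⊵ d′ →
    ∃[ K′ ] (IsKFamily k K′ × deg K′ ≡ d′ × Swings k K′ K)
  swings-to-degree K (acc smaller) isK dom with ≡-dec _≟ℕ_ (deg K) d′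
  ... | yes degK≡d′ = K , isK , degK≡d′ , ε
  ... | no degK≢d′ =
    let i , j , i<j , dj<di , gap = dominance-gap (deg K) d′ d′↓ dom degK≢d′
        K″ , isK″ , swing , move = reverse-swing isK i<j dj<di
        K′ , isK′ , degK′≡d′ , swings = swings-to-degree K″ (smaller (MoveUnit-potential-< i<j move)) isK″
                                          (MoveUnit-⊵-preserved i<j move dom gap)
    in K′ , isK′ , degK′≡d′ , swings ◅◅ (swing ◅ ε)

proposition2p20 : (n k : ℕ) (K : Family n) → IsKFamily k K → WeaklyDecreasing (deg K)
    → (CanSwing k K ⇔ (¬ Shifted k K))
      × (∀ K' → Swing k K K' → deg K' ⊳ deg K)
      × (∀ (d' : Vec ℕ n) → WeaklyDecreasing d' → Positive d' → deg K ⊵ d'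
          → ∃[ K' ] (IsKFamily k K' × deg K' ≡ d' × Swings k K' K))
proposition2p20 n k K isK _ =
  CanSwing⇔¬Shifted k K ,
  (λ _ → swing-⊳) ,
  λ d′ d′↓ _ dom → swings-to-degree d′↓ K (<-wellFounded _) isK dom
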